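{- Let $G=(V,E)$ be a finite graph and for $n\ge2$ let $h_{out}(n)=\min_{V_1,\dots,V_n}\max_{1\le i\le n}\frac{|\partial_{out}V_i|}{|V_i|}$, the minimum over all collections of nonempty, pairwise disjoint sets $V_1,\dots,V_n\subset V$ with $\bigcup_iV_i=V$. Then for every $n\ge3$ (with $n\le|V|$), $h_{out}(n-1)\le h_{out}(n)$.
   Context: For $S\subset V$, $\partial_{out}S=\{y\notin S:\exists x\in S,\ x\sim y\}$. -}

module Defs where

open import Data.Bool using (Bool; true; false; not; _∧_)
open import Data.Nat using (ℕ; zero; suc)
open import Data.Fin using (Fin; zero; suc)
open import Data.Fin.Subset using (Subset; _∈_; _∩_; ∣_∣; Nonempty; Empty)
open import Data.Vec using (tabulate; lookup)
open import Data.List using (allFin)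
open import Data.Bool.ListAction using (any)
open import Data.Integer using (+_)
open import Data.Rational using (ℚ; _/_; _⊔_; 0ℚ)
open import Data.Product using (Σ; ∃; _×_)
open import Relation.Binary.PropositionalEquality using (_≡_; _≢_)

record Graph (N : ℕ) : Set where
  field
    adj   : Fin N → Fin N → Bool
    sym   : ∀ x y → adj x y ≡ adj y x
    irrefl : ∀ x → adj x x ≡ false

open Graph public

∂out : ∀ {N} → Graph N → Subset N → Subset N
∂out {N} G S = tabulate λ y →
  not (lookup S y) ∧ any (λ x → lookup S x ∧ adj G x y) (allFin N)

-- |∂_out S| / |S|  (only used for nonempty S; set to 0 when S = ∅)
ratioSize : ℕ → ℕ → ℚ
ratioSize b zero    = 0ℚ
ratioSize b (suc k) = (+ b) / suc k

ratio : ∀ {N} → Graph N → Subset N → ℚ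
ratio G S = ratioSize ∣ ∂out G S ∣ ∣ S ∣

-- maximum of finitely many rationals (0 for the empty family;
-- all ratios are ≥ 0 so this is the usual max for n ≥ 1)
maxFin : (k : ℕ) → (Fin k → ℚ) → ℚ
maxFin zero    f = 0ℚ
maxFin (suc k) f = f zero ⊔ maxFin k (λ i → f (suc i))

record Partition {N : ℕ} (n : ℕ) : Set where
  field
    part     : Fin n → Subset N
    nonempty : ∀ i → Nonempty (part i)
    disjoint : ∀ i j → i ≢ j → Empty (part i ∩ part j)
    covers   : ∀ (x : Fin N) → ∃ λ i → x ∈ part i

open Partition public

cost : ∀ {N} (G : Graph N) {n : ℕ} → Partition {N} n → ℚ
cost G {n} P = maxFin n (λ i → ratio G (part P i))

-- "c = h_out(n)": c is the minimum of cost over all partitions into n parts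
-- (attained, and a lower bound).
IsHout : ∀ {N} → Graph N → ℕ → ℚ → Set
IsHout {N} G n c =
  (Σ (Partition {N} n) λ P → cost G P ≡ c)
  × (∀ (P : Partition {N} n) → c Data.Rational.≤ cost G P)

module Submission where

-- Idea: take a partition V₁,…,Vₙ attaining h_out(n) and merge V₁ and V₂.
-- The result is a partition into n-1 parts, and its cost is no larger:
--   * the outer boundary is subadditive, ∂(A ∪ B) ⊆ ∂A ∪ ∂B, so
--     |∂(A ∪ B)| ≤ |∂A| + |∂B|, while |A ∪ B| = |A| + |B| for disjoint A, B;
--   * by the mediant inequality, d/(a + b) ≤ max(dA/a, dB/b) when d ≤ dA + dB.
-- Hence the ratio of the merged part is at most the larger of the two old
-- ratios, the other parts are unchanged, and therefore
-- h_out(n-1) ≤ cost(merged) ≤ cost(original) = h_out(n).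

open import Defs
open import Data.Nat using (ℕ; _≤_; _∸_)
open import Data.Rational using (ℚ)

open import Data.Nat using (zero; suc; _+_; _*_; z≤n; s≤s)
import Data.Nat.Properties as ℕ
open import Data.Bool using (Bool; true; false; T; not; _∧_)
open import Data.Bool.Properties using (T-≡; T-not-≡; T-∧)
open import Data.Fin using (Fin)
import Data.Fin as Fin
import Data.Fin.Properties as Fin
open import Data.Fin.Subset
  using (Subset; _∈_; _∉_; _⊆_; _∪_; _∩_; ∣_∣; ⁅_⁆; Nonempty; Empty)
open import Data.Fin.Subset.Properties
  using ( x∈p∩q⁻; x∈p∩q⁺; x∈p∪q⁻; x∈p∪q⁺; p⊆p∪q; q⊆p∪q; ∩-comm
        ; Empty-unique; ∣⊥∣≡0; x∈⁅y⁆⇒x≡y; ∣⁅x⁆∣≡1; p⊆q⇒∣p∣≤∣q∣ )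
open import Data.Vec using (_∷_; []; lookup)
open import Data.Vec.Properties using ([]=⇒lookup; lookup⇒[]=; lookup∘tabulate)
open import Data.List using (allFin)
open import Data.List.Relation.Unary.Any using (satisfied)
open import Data.List.Relation.Unary.Any.Properties using (any⁺; any⁻)
open import Data.List.Membership.Propositional using (lose)
open import Data.List.Membership.Propositional.Properties using (∈-allFin)
open import Data.Bool.ListAction using (any)
open import Data.Product using (∃; _×_; _,_)
open import Data.Sum using (inj₁; inj₂)
open import Function using (_∘_; Equivalence)
open import Relation.Nullary using (contradiction)
open import Relation.Binary.PropositionalEquality
  using (_≡_; _≢_; refl; trans; cong; subst; subst₂; module ≡-Reasoning)
  renaming (sym to ≡-sym)
import Data.Integer as ℤ
import Data.Integer.Properties as ℤ
import Data.Rational as ℚ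
import Data.Rational.Properties as ℚ
import Data.Rational.Unnormalised as ℚᵘ
import Data.Rational.Unnormalised.Properties as ℚᵘ

open Equivalence using (to; from)

∈⇒T : ∀ {n} {p : Subset n} {x : Fin n} → x ∈ p → T (lookup p x)
∈⇒T x∈p rewrite []=⇒lookup x∈p = _

T⇒∈ : ∀ {n} {p : Subset n} {x : Fin n} → T (lookup p x) → x ∈ p
T⇒∈ {p = p} {x} t = lookup⇒[]= x p (to T-≡ t)

∉⇒lookup≡false : ∀ {n} {p : Subset n} {x : Fin n} → x ∉ p → lookup p x ≡ false
∉⇒lookup≡false {p = p} {x} x∉p with lookup p x in eq
... | true  = contradiction (lookup⇒[]= x p eq) x∉p
... | false = refl

neighbourIn : ∀ {N} → Graph N → Subset N → Fin N → Fin N → Bool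
neighbourIn G S y x = lookup S x ∧ adj G x y

boundaryTest : ∀ {N} → Graph N → Subset N → Fin N → Bool
boundaryTest {N} G S y = not (lookup S y) ∧ any (neighbourIn G S y) (allFin N)

lookup-∂out : ∀ {N} (G : Graph N) (S : Subset N) (y : Fin N) →
              lookup (∂out G S) y ≡ boundaryTest G S y
lookup-∂out G S y = lookup∘tabulate (boundaryTest G S) y

∂out⁻ : ∀ {N} (G : Graph N) (S : Subset N) {y : Fin N} →
        y ∈ ∂out G S → y ∉ S × ∃ λ x → x ∈ S × T (adj G x y)
∂out⁻ {N} G S {y} y∈∂S
  with to T-∧ (subst T (lookup-∂out G S y) (∈⇒T y∈∂S))
... | y∉S , hasNeighbour with satisfied (any⁻ (neighbourIn G S y) (allFin N) hasNeighbour)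
...   | x , x∈S∧x∼y with to T-∧ x∈S∧x∼y
...     | x∈S , x∼y = y∉S′ , x , T⇒∈ x∈S , x∼y
  where
  y∉S′ : y ∉ S
  y∉S′ y∈S with trans (≡-sym ([]=⇒lookup y∈S)) (to T-not-≡ y∉S)
  ... | ()

∂out⁺ : ∀ {N} (G : Graph N) (S : Subset N) {x y : Fin N} →
        y ∉ S → x ∈ S → T (adj G x y) → y ∈ ∂out G S
∂out⁺ G S {x} {y} y∉S x∈S x∼y =
  T⇒∈ (subst T (≡-sym (lookup-∂out G S y)) (from T-∧ (y∉S′ , hasNeighbour)))
  where
  y∉S′ = from T-not-≡ (∉⇒lookup≡false y∉S)
  hasNeighbour = any⁺ (neighbourIn G S y) (lose (∈-allFin x) (from T-∧ (∈⇒T x∈S , x∼y)))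

∂out-∪ : ∀ {N} (G : Graph N) (A B : Subset N) → ∂out G (A ∪ B) ⊆ ∂out G A ∪ ∂out G B
∂out-∪ G A B y∈∂ with ∂out⁻ G (A ∪ B) y∈∂
... | y∉A∪B , x , x∈A∪B , x∼y with x∈p∪q⁻ A B x∈A∪B
...   | inj₁ x∈A = x∈p∪q⁺ (inj₁ (∂out⁺ G A (y∉A∪B ∘ p⊆p∪q B) x∈A x∼y))
...   | inj₂ x∈B = x∈p∪q⁺ (inj₂ (∂out⁺ G B (y∉A∪B ∘ q⊆p∪q A B) x∈B x∼y))

∣p∪q∣+∣p∩q∣ : ∀ {n} (p q : Subset n) → ∣ p ∪ q ∣ + ∣ p ∩ q ∣ ≡ ∣ p ∣ + ∣ q ∣
∣p∪q∣+∣p∩q∣ []          []          = refl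
∣p∪q∣+∣p∩q∣ (false ∷ p) (false ∷ q) = ∣p∪q∣+∣p∩q∣ p q
∣p∪q∣+∣p∩q∣ (true  ∷ p) (false ∷ q) = cong suc (∣p∪q∣+∣p∩q∣ p q)
∣p∪q∣+∣p∩q∣ (false ∷ p) (true  ∷ q) =
  trans (cong suc (∣p∪q∣+∣p∩q∣ p q)) (≡-sym (ℕ.+-suc ∣ p ∣ ∣ q ∣))
∣p∪q∣+∣p∩q∣ (true  ∷ p) (true  ∷ q) = cong suc (begin
  ∣ p ∪ q ∣ + suc ∣ p ∩ q ∣ ≡⟨ ℕ.+-suc ∣ p ∪ q ∣ ∣ p ∩ q ∣ ⟩
  suc (∣ p ∪ q ∣ + ∣ p ∩ q ∣) ≡⟨ cong suc (∣p∪q∣+∣p∩q∣ p q) ⟩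
  suc (∣ p ∣ + ∣ q ∣)         ≡⟨ ℕ.+-suc ∣ p ∣ ∣ q ∣ ⟨
  ∣ p ∣ + suc ∣ q ∣           ∎)
  where open ≡-Reasoning

∣p∪q∣≤∣p∣+∣q∣ : ∀ {n} (p q : Subset n) → ∣ p ∪ q ∣ ≤ ∣ p ∣ + ∣ q ∣
∣p∪q∣≤∣p∣+∣q∣ p q = subst (∣ p ∪ q ∣ ≤_) (∣p∪q∣+∣p∩q∣ p q) (ℕ.m≤m+n _ _)

∣p∪q∣≡∣p∣+∣q∣ : ∀ {n} (p q : Subset n) → Empty (p ∩ q) → ∣ p ∪ q ∣ ≡ ∣ p ∣ + ∣ q ∣
∣p∪q∣≡∣p∣+∣q∣ {n} p q p∩q=∅ = begin
  ∣ p ∪ q ∣                 ≡⟨ ℕ.+-identityʳ _ ⟨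
  ∣ p ∪ q ∣ + 0             ≡⟨ cong (∣ p ∪ q ∣ +_) ∣p∩q∣≡0 ⟨
  ∣ p ∪ q ∣ + ∣ p ∩ q ∣     ≡⟨ ∣p∪q∣+∣p∩q∣ p q ⟩
  ∣ p ∣ + ∣ q ∣             ∎
  where
  open ≡-Reasoning
  ∣p∩q∣≡0 : ∣ p ∩ q ∣ ≡ 0
  ∣p∩q∣≡0 = trans (cong ∣_∣ (Empty-unique p∩q=∅)) (∣⊥∣≡0 n)

nonempty⇒∣p∣≡suc : ∀ {n} (p : Subset n) → Nonempty p → ∃ λ a → ∣ p ∣ ≡ suc a
nonempty⇒∣p∣≡suc p (x , x∈p) with ∣ p ∣ | ⁅x⁆≤∣p∣
  where
  ⁅x⁆≤∣p∣ : ∣ ⁅ x ⁆ ∣ ≤ ∣ p ∣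
  ⁅x⁆≤∣p∣ = p⊆q⇒∣p∣≤∣q∣ λ y∈⁅x⁆ → subst (_∈ p) (≡-sym (x∈⁅y⁆⇒x≡y x y∈⁅x⁆)) x∈p
... | suc a | _ = a , refl
... | zero  | 1≤0 = contradiction (subst (_≤ 0) (∣⁅x⁆∣≡1 x) 1≤0) λ ()

∪-disjoint : ∀ {n} (p q r : Subset n) → Empty (p ∩ r) → Empty (q ∩ r) → Empty ((p ∪ q) ∩ r)
∪-disjoint p q r p∩r=∅ q∩r=∅ (x , x∈[p∪q]∩r) with x∈p∩q⁻ (p ∪ q) r x∈[p∪q]∩r
... | x∈p∪q , x∈r with x∈p∪q⁻ p q x∈p∪q
...   | inj₁ x∈p = p∩r=∅ (x , x∈p∩q⁺ (x∈p , x∈r))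
...   | inj₂ x∈q = q∩r=∅ (x , x∈p∩q⁺ (x∈q , x∈r))

fromℚᵘ-mono-≤ : ∀ {p q} → p ℚᵘ.≤ q → ℚ.fromℚᵘ p ℚ.≤ ℚ.fromℚᵘ q
fromℚᵘ-mono-≤ {p} {q} p≤q = ℚ.toℚᵘ-cancel-≤
  (ℚᵘ.≤-trans (ℚᵘ.≤-reflexive (ℚ.toℚᵘ-fromℚᵘ p))
    (ℚᵘ.≤-trans p≤q (ℚᵘ.≤-reflexive (ℚᵘ.≃-sym (ℚ.toℚᵘ-fromℚᵘ q)))))

ratioSize-≤ : ∀ b k b′ k′ → b * suc k′ ≤ b′ * suc k →
              ratioSize b (suc k) ℚ.≤ ratioSize b′ (suc k′)
ratioSize-≤ b k b′ k′ cross = fromℚᵘ-mono-≤ {ℚᵘ.mkℚᵘ (ℤ.+ b) k} {ℚᵘ.mkℚᵘ (ℤ.+ b′) k′}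
  (ℚᵘ.*≤* (subst₂ ℤ._≤_ (ℤ.pos-* b (suc k′)) (ℤ.pos-* b′ (suc k)) (ℤ.+≤+ cross)))

-- Mediant inequality, cross-multiplied: if dA/a ≤ dB/b and d ≤ dA + dB,
-- then d/(a+b) ≤ dB/b.
mediant-cross : ∀ {d dA dB a b} → d ≤ dA + dB → dA * b ≤ dB * a → d * b ≤ dB * (a + b)
mediant-cross {d} {dA} {dB} {a} {b} d≤dA+dB A≤B = begin
  d * b               ≤⟨ ℕ.*-monoˡ-≤ b d≤dA+dB ⟩
  (dA + dB) * b       ≡⟨ ℕ.*-distribʳ-+ b dA dB ⟩
  dA * b + dB * b     ≤⟨ ℕ.+-monoˡ-≤ (dB * b) A≤B ⟩
  dB * a + dB * b     ≡⟨ ℕ.*-distribˡ-+ dB a b ⟨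
  dB * (a + b)        ∎
  where open ℕ.≤-Reasoning

mediant : ∀ d dA dB a b → d ≤ dA + dB →
          ratioSize d (suc a + suc b) ℚ.≤ ratioSize dA (suc a) ℚ.⊔ ratioSize dB (suc b)
mediant d dA dB a b d≤dA+dB with ℕ.≤-total (dA * suc b) (dB * suc a)
... | inj₁ A≤B = ℚ.≤-trans
  (ratioSize-≤ d (a + suc b) dB b (mediant-cross {d} {dA} {dB} {suc a} {suc b} d≤dA+dB A≤B))
  (ℚ.p≤q⊔p (ratioSize dA (suc a)) (ratioSize dB (suc b)))
... | inj₂ B≤A = ℚ.≤-trans
  (ratioSize-≤ d (a + suc b) dA a
    (subst (d * suc a ≤_) (cong (dA *_) (ℕ.+-comm (suc b) (suc a)))
      (mediant-cross {d} {dB} {dA} {suc b} {suc a} (subst (d ≤_) (ℕ.+-comm dA dB) d≤dA+dB) B≤A)))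
  (ℚ.p≤p⊔q (ratioSize dA (suc a)) (ratioSize dB (suc b)))

ratio-∪ : ∀ {N} (G : Graph N) (A B : Subset N) → Nonempty A → Nonempty B → Empty (A ∩ B) →
          ratio G (A ∪ B) ℚ.≤ ratio G A ℚ.⊔ ratio G B
ratio-∪ G A B A≠∅ B≠∅ A∩B=∅
  with nonempty⇒∣p∣≡suc A A≠∅ | nonempty⇒∣p∣≡suc B B≠∅
... | a , ∣A∣≡1+a | b , ∣B∣≡1+b = goal
  where
  ∂A∪B ∂A ∂B : ℕ
  ∂A∪B = ∣ ∂out G (A ∪ B) ∣
  ∂A   = ∣ ∂out G A ∣
  ∂B   = ∣ ∂out G B ∣

  ∂-bound : ∂A∪B ≤ ∂A + ∂B
  ∂-bound = ℕ.≤-trans (p⊆q⇒∣p∣≤∣q∣ (∂out-∪ G A B)) (∣p∪q∣≤∣p∣+∣q∣ (∂out G A) (∂out G B))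

  goal : ratioSize ∂A∪B ∣ A ∪ B ∣ ℚ.≤ ratioSize ∂A ∣ A ∣ ℚ.⊔ ratioSize ∂B ∣ B ∣
  goal rewrite ∣p∪q∣≡∣p∣+∣q∣ A B A∩B=∅ | ∣A∣≡1+a | ∣B∣≡1+b = mediant ∂A∪B ∂A ∂B a b ∂-bound

module Merge {N k : ℕ} (P : Partition {N} (suc (suc (suc k)))) where

  V₀ V₁ : Subset N
  V₀ = part P Fin.zero
  V₁ = part P (Fin.suc Fin.zero)

  mergedPart : Fin (suc (suc k)) → Subset N
  mergedPart Fin.zero    = V₀ ∪ V₁
  mergedPart (Fin.suc i) = part P (Fin.suc (Fin.suc i))

  mergedNonempty : ∀ i → Nonempty (mergedPart i)
  mergedNonempty Fin.zero with nonempty P Fin.zero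
  ... | x , x∈V₀ = x , p⊆p∪q V₁ x∈V₀
  mergedNonempty (Fin.suc i) = nonempty P (Fin.suc (Fin.suc i))

  mergedDisjoint : ∀ i j → i ≢ j → Empty (mergedPart i ∩ mergedPart j)
  mergedDisjoint Fin.zero Fin.zero 0≢0 = contradiction refl 0≢0
  mergedDisjoint Fin.zero (Fin.suc j) _ = ∪-disjoint V₀ V₁ _
    (disjoint P Fin.zero (Fin.suc (Fin.suc j)) λ ())
    (disjoint P (Fin.suc Fin.zero) (Fin.suc (Fin.suc j)) λ ())
  mergedDisjoint (Fin.suc i) Fin.zero _ =
    subst Empty (∩-comm (V₀ ∪ V₁) _) (mergedDisjoint Fin.zero (Fin.suc i) λ ())
  mergedDisjoint (Fin.suc i) (Fin.suc j) i≢j =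
    disjoint P _ _ (i≢j ∘ Fin.suc-injective)

  mergedCovers : ∀ x → ∃ λ i → x ∈ mergedPart i
  mergedCovers x with covers P x
  ... | Fin.zero            , x∈V₀ = Fin.zero , p⊆p∪q V₁ x∈V₀
  ... | Fin.suc Fin.zero    , x∈V₁ = Fin.zero , q⊆p∪q V₀ V₁ x∈V₁
  ... | Fin.suc (Fin.suc i) , x∈Vᵢ = Fin.suc i , x∈Vᵢ

  merged : Partition {N} (suc (suc k))
  merged = record
    { part = mergedPart ; nonempty = mergedNonempty
    ; disjoint = mergedDisjoint ; covers = mergedCovers }

  merged-cost : (G : Graph N) → cost G merged ℚ.≤ cost G P
  merged-cost G = begin
    ratio G (V₀ ∪ V₁) ℚ.⊔ rest         ≤⟨ ℚ.⊔-monoˡ-≤ rest (ratio-∪ G V₀ V₁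
                                            (nonempty P Fin.zero) (nonempty P (Fin.suc Fin.zero))
                                            (disjoint P Fin.zero (Fin.suc Fin.zero) λ ())) ⟩
    (ratio G V₀ ℚ.⊔ ratio G V₁) ℚ.⊔ rest ≡⟨ ℚ.⊔-assoc (ratio G V₀) (ratio G V₁) rest ⟩
    ratio G V₀ ℚ.⊔ (ratio G V₁ ℚ.⊔ rest) ∎
    where
    open ℚ.≤-Reasoning
    rest = maxFin (suc k) (λ i → ratio G (part P (Fin.suc (Fin.suc i))))

open Merge using (merged; merged-cost)

proposition5p14 : ∀ {N : ℕ} (G : Graph N) (n : ℕ) → 3 ≤ n → n ≤ N →
    ∀ (c c′ : ℚ) → IsHout G (n ∸ 1) c′ → IsHout G n c → c′ Data.Rational.≤ c
proposition5p14 G (suc (suc (suc k))) (s≤s (s≤s (s≤s z≤n))) _ c c′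
                (_ , c′-lower-bound) ((P , cost≡c) , _) = begin
  c′                 ≤⟨ c′-lower-bound (merged P) ⟩
  cost G (merged P)  ≤⟨ merged-cost P G ⟩
  cost G P           ≡⟨ cost≡c ⟩
  c                  ∎
  where open ℚ.≤-Reasoning
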